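{- Assume $L_{\mathrm{co}}\ne l^\star$ and that the sticks are indexed in non-increasing order, $L_1\ge L_2\ge\cdots\ge L_n$ (so that $I_{\mathrm{co}}=\{1,\dots,|I_{\mathrm{co}}|\}$ and $L_i=L^{(i)}$). Then the restriction $(I_{\mathrm{co}},1,f_u)$ with $f_l\equiv1$ and $f_u(i)=\lceil k/i\rceil$ is admissible. Furthermore, in the worst case $|\mathbf{C}(I_{\mathrm{co}},1,i\mapsto\lceil k/i\rceil)|\in\Theta\bigl(k\cdot\log(\min(k,n))\bigr)$.
   Context: Let $\mathbf{L}=\{L_1,\dots,L_n\}$ be a multiset of positive rationals and $k\in\mathbb{N}_{>0}$. Let $m(l)=\sum_i\lfloor L_i/l\rfloor$; $l$ is feasible if $m(l)\ge k$; $l^\star=\max\{l\in\mathbb{Q}_{>0}\mid m(l)\ge k\}$. $L^{(r)}$ is the $r$-th largest element of $\mathbf{L}$. $L_{\mathrm{co}}=L^{(k)}$ if $k\le n$, else $0$; when $L_{\mathrm{co}}\ne l^\star$, $I_{\mathrm{co}}=\{i\mid L_i>L_{\mathrm{co}}\}$. $\mathbf{C}(I,f_l,f_u)=\biguplus_{i\in I}\{L_i/j\mid f_l(i)\le j\le f_u(i)\}$ (multiset union). A triple $(I,f_l,f_u)$ with $f_l,f_u:I\to\mathbb{N}$ is admissible if for all $i\in I$: $f_l(i)=1$ or $L_i/(f_l(i)-1)$ is infeasible; $L_i/f_u(i)$ is feasible; and for all $i'\notin I$, $L_{i'}$ is feasible and $L_{i'}\ne l^\star$. "Worst case" refers to the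 maximum over inputs with given $n$ and $k$. -}

module Defs where

open import Data.Nat as ℕ using (ℕ; zero; suc; _∸_; _+_)
open import Data.Nat.DivMod using (_/_)
open import Data.Integer as ℤ using (ℤ; +_)
open import Data.Rational as ℚ using (ℚ; 0ℚ; floor; _÷_; positive)
open import Data.Rational.Properties using (_<?_; pos⇒nonZero)
open import Data.Fin using (Fin; toℕ; fromℕ<)
open import Data.List using (List; []; map; concat; upTo; length)
open import Data.List.Base using (allFin)
open import Data.Bool using (Bool; if_then_else_)
open import Data.Product using (Σ; _×_; ∃)
open import Data.Sum using (_⊎_)
open import Relation.Nullary using (¬_; does; yes; no)
open import Relation.Binary.PropositionalEquality using (_≡_)

-- Sticks: a multiset of n rationals, represented as an indexed family.
-- Paper index i ∈ {1..n} corresponds to (i' : Fin n) with toℕ i' = i - 1.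
Sticks : ℕ → Set
Sticks n = Fin n → ℚ

AllPositive : ∀ {n} → Sticks n → Set
AllPositive L = ∀ i → 0ℚ ℚ.< L i

NonIncreasing : ∀ {n} → Sticks n → Set
NonIncreasing L = ∀ i j → toℕ i ℕ.≤ toℕ j → L j ℚ.≤ L i

Σℤ : (n : ℕ) → (Fin n → ℤ) → ℤ
Σℤ zero f = + 0
Σℤ (suc n) f = f Fin.zero ℤ.+ Σℤ n (λ i → f (Fin.suc i))
  where import Data.Fin as Fin

m : ∀ {n} → Sticks n → (l : ℚ) → 0ℚ ℚ.< l → ℤ
m {n} L l 0<l = Σℤ n (λ i → floor ((L i ÷ l) {{pos⇒nonZero l {{positive 0<l}}}}))

Feasible : ∀ {n} → ℕ → Sticks n → ℚ → Set
Feasible k L l = Σ (0ℚ ℚ.< l) (λ 0<l → + k ℤ.≤ m L l 0<l)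

IsLstar : ∀ {n} → ℕ → Sticks n → ℚ → Set
IsLstar k L l = Feasible k L l × (∀ l' → Feasible k L l' → l' ℚ.≤ l)

-- L_co = L^(k) if k ≤ n, else 0.  Under the standing assumption that L is
-- non-increasing, L^(k) (the k-th largest) is the k-th stick L_k.
Lco : ∀ {n} → ℕ → Sticks n → ℚ
Lco k L = go k
  where
  go : ℕ → ℚ
  go zero = 0ℚ   -- k = 0 is excluded by hypothesis (k ∈ ℕ>0)
  go (suc k') with k' ℕ.<? _
  ... | yes p = L (fromℕ< p)
  ... | no _  = 0ℚ

IndexSet : ℕ → Set
IndexSet n = Fin n → Bool

_∈I_ : ∀ {n} → Fin n → IndexSet n → Set
i ∈I I = I i ≡ Bool.true
  where import Data.Bool as Bool

Ico : ∀ {n} → ℕ → Sticks n → IndexSet n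
Ico k L i = does (Lco k L <? L i)

-- L / j for a natural j ≥ 1 (value at j = 0 is an unused junk value 0)
divN : ℚ → ℕ → ℚ
divN L zero = 0ℚ
divN L (suc j) = L ℚ.* (+ 1 ℚ./ suc j)

-- the multiset C(I, f_l, f_u) = ⊎_{i∈I} { L_i / j | f_l(i) ≤ j ≤ f_u(i) }, as a list
C : ∀ {n} → Sticks n → IndexSet n → (Fin n → ℕ) → (Fin n → ℕ) → List ℚ
C {n} L I fl fu =
  concat (map (λ i → if I i
                      then map (λ t → divN (L i) (fl i + t)) (upTo (suc (fu i) ∸ fl i))
                      else [])
              (allFin n))

Admissible : ∀ {n} → ℕ → Sticks n → IndexSet n → (Fin n → ℕ) → (Fin n → ℕ) → Set
Admissible k L I fl fu =
  (∀ i → i ∈I I →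
     (fl i ≡ 1 ⊎ Σ ℕ (λ p → fl i ≡ suc (suc p) × ¬ Feasible k L (divN (L i) (suc p))))
     × Σ ℕ (λ q → fu i ≡ suc q × Feasible k L (divN (L i) (suc q))))
  × (∀ i → ¬ (i ∈I I) → Feasible k L (L i) × ¬ IsLstar k L (L i))

⌈_/_⌉ : ℕ → (b : ℕ) → .{{_ : ℕ.NonZero b}} → ℕ
⌈ a / b ⌉ = (a + b ∸ 1) / b

-- f_u(i) = ⌈k / i⌉ with paper index i = toℕ i' + 1
fuCo : ∀ {n} → ℕ → Fin n → ℕ
fuCo k i = ⌈ k / suc (toℕ i) ⌉

one : ∀ {n} → Fin n → ℕ
one _ = 1

sizeCco : ∀ {n} → ℕ → Sticks n → ℕ
sizeCco k L = length (C L (Ico k L) one (fuCo k))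

ValidInput : ∀ {n} → ℕ → Sticks n → Set
ValidInput k L = AllPositive L × NonIncreasing L × ¬ IsLstar k L (Lco k L)

-- Each of the i longest sticks is at least L_i long, so it yields ⌈k/i⌉ pieces of length
-- L_i/⌈k/i⌉, and i·⌈k/i⌉ ≥ k: this length is feasible.  A stick outside I_co has
-- L_i ≤ L_co = L_k, and every positive length up to L_k is feasible (the k longest sticks give
-- one piece each); L_i = l⋆ would force l⋆ ≤ L_k ≤ l⋆, i.e. L_co = l⋆.
--
-- Every index of I_co is smaller than k, so |C| is at most Σ_{i ≤ min(k,n)} ⌈k/i⌉.  Grouping
-- the terms into dyadic blocks 2^p ≤ i < 2^(p+1) (prefix lengths 2^p − 1), each block sums to
-- between k/2 and k + 2^p − 1; this brackets the sum between k·log₂ min(k,n) / 2 and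
-- 4k·log₂ min(k,n).  The lower bound is attained by k − 1 sticks of length 3 followed by
-- sticks of length 1: there I_co consists of the first min(k − 1, n) sticks, and L_co ≠ l⋆
-- because 3/2 is feasible.

module Submission where

open import Defs
open import Data.Nat
open import Data.Nat.Properties
open import Data.Nat.DivMod
  using (_/_; _%_; m≡m%n+[m/n]*n; m%n<n; m/n*n≤m; /-monoˡ-≤; /-monoʳ-≤; m/n≡1+[m∸n]/n; m<n⇒m/n≡0; m*n/n≡m)
open import Data.Nat.Induction using (<-rec)
open import Data.Nat.Logarithm
open import Data.Nat.Tactic.RingSolver using (solve-∀)
open import Data.Integer as ℤ using (ℤ; +_; -[1+_]; +≤+)
import Data.Integer.Properties as ℤP
open import Data.Rational as ℚ using (ℚ; mkℚ; 0ℚ; 1ℚ; floor; _÷_; 1/_; positive)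
import Data.Rational.Properties as ℚP
import Data.Rational.Unnormalised as ℚᵘ
import Data.Rational.Unnormalised.Properties as ℚᵘP
open import Data.Fin using (Fin; toℕ; fromℕ<)
open import Data.Fin.Properties using (toℕ-fromℕ<; toℕ<n)
import Data.Fin as Fin
open import Data.Nat.Coprimality as Coprimality using (1-coprimeTo)
open import Data.Sum using (_⊎_; inj₁; inj₂)
open import Data.Product using (Σ; _×_; _,_)
open import Data.Empty using (⊥-elim)
open import Data.Bool using (true; false; if_then_else_)
open import Data.List using (List; []; _∷_; map; concat; length; tabulate; upTo; allFin)
open import Data.Nat.ListAction using (sum)
open import Data.List.Properties using (length-++; length-map; length-upTo; map-∘; map-tabulate; tabulate-cong)
open import Function using (_∘_; id)
open import Relation.Binary.PropositionalEquality
open import Relation.Nullary using (¬_; yes; no; proof)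
open import Relation.Nullary.Reflects using (Reflects; invert)
open import Relation.Nullary.Decidable using (dec-true; from-yes; from-no)

∑< : ℕ → (ℕ → ℕ) → ℕ
∑< zero    f = 0
∑< (suc m) f = f 0 + ∑< m (λ i → f (suc i))

∑<-split : ∀ a b f → ∑< (a + b) f ≡ ∑< a f + ∑< b (λ i → f (a + i))
∑<-split zero    b f = refl
∑<-split (suc a) b f =
  trans (cong (_+_ (f 0)) (∑<-split a b (λ i → f (suc i)))) (sym (+-assoc (f 0) _ _))

∑<-mono-≤ : ∀ {a b} f → a ≤ b → ∑< a f ≤ ∑< b f
∑<-mono-≤ {a} {b} f a≤b = begin
  ∑< a f                                  ≤⟨ m≤m+n (∑< a f) _ ⟩
  ∑< a f + ∑< (b ∸ a) (λ i → f (a + i))   ≡⟨ ∑<-split a (b ∸ a) f ⟨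
  ∑< (a + (b ∸ a)) f                      ≡⟨ cong (λ x → ∑< x f) (m+[n∸m]≡n a≤b) ⟩
  ∑< b f                                  ∎
  where open ≤-Reasoning

∑<-≤-* : ∀ m f {c} → (∀ i → f i ≤ c) → ∑< m f ≤ m * c
∑<-≤-* zero    f f≤c = z≤n
∑<-≤-* (suc m) f f≤c = +-mono-≤ (f≤c 0) (∑<-≤-* m (λ i → f (suc i)) (λ i → f≤c (suc i)))

*-≤-∑< : ∀ m f {c} → (∀ i → i < m → c ≤ f i) → m * c ≤ ∑< m f
*-≤-∑< zero    f c≤f = z≤n
*-≤-∑< (suc m) f c≤f =
  +-mono-≤ (c≤f 0 z<s) (*-≤-∑< m (λ i → f (suc i)) (λ i i<m → c≤f (suc i) (s<s i<m)))

⌈m/1+j⌉≡[m+j]/1+j : ∀ m j → ⌈ m / suc j ⌉ ≡ (m + j) / suc j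
⌈m/1+j⌉≡[m+j]/1+j m j = cong (λ x → (x ∸ 1) / suc j) (+-suc m j)

m≤⌈m/n⌉*n : ∀ m n .{{_ : NonZero n}} → m ≤ ⌈ m / n ⌉ * n
m≤⌈m/n⌉*n m (suc j) = +-cancelʳ-≤ j m (⌈ m / suc j ⌉ * suc j) (begin
  m + j                                   ≡⟨ m≡m%n+[m/n]*n (m + j) (suc j) ⟩
  (m + j) % suc j + (m + j) / suc j * suc j ≤⟨ +-monoˡ-≤ _ (≤-pred (m%n<n (m + j) (suc j))) ⟩
  j + (m + j) / suc j * suc j             ≡⟨ +-comm j _ ⟩
  (m + j) / suc j * suc j + j             ≡⟨ cong (λ q → q * suc j + j) (⌈m/1+j⌉≡[m+j]/1+j m j) ⟨
  ⌈ m / suc j ⌉ * suc j + j               ∎)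
  where open ≤-Reasoning

⌈m/1+j⌉*[1+j]≤m+j : ∀ m j → ⌈ m / suc j ⌉ * suc j ≤ m + j
⌈m/1+j⌉*[1+j]≤m+j m j = begin
  ⌈ m / suc j ⌉ * suc j      ≡⟨ cong (_* suc j) (⌈m/1+j⌉≡[m+j]/1+j m j) ⟩
  (m + j) / suc j * suc j    ≤⟨ m/n*n≤m (m + j) (suc j) ⟩
  m + j                      ∎
  where open ≤-Reasoning

⌈1+m/n⌉≡1+m/n : ∀ m n .{{_ : NonZero n}} → ⌈ suc m / n ⌉ ≡ suc (m / n)
⌈1+m/n⌉≡1+m/n m n = trans (m/n≡1+[m∸n]/n (m≤n+m n m)) (cong (λ x → suc (x / n)) (m+n∸n≡m m n))

⌈m/n⌉-antiʳ-≤ : ∀ m {n o} .{{_ : NonZero n}} .{{_ : NonZero o}} → n ≤ o → ⌈ m / o ⌉ ≤ ⌈ m / n ⌉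
⌈m/n⌉-antiʳ-≤ zero    {suc n} {suc o} _ =
  ≤-reflexive (trans (m<n⇒m/n≡0 (n<1+n o)) (sym (m<n⇒m/n≡0 (n<1+n n))))
⌈m/n⌉-antiʳ-≤ (suc m) {n} {o} n≤o = begin
  ⌈ suc m / o ⌉  ≡⟨ ⌈1+m/n⌉≡1+m/n m o ⟩
  suc (m / o)    ≤⟨ s≤s (/-monoʳ-≤ m n≤o) ⟩
  suc (m / n)    ≡⟨ ⌈1+m/n⌉≡1+m/n m n ⟨
  ⌈ suc m / n ⌉  ∎
  where open ≤-Reasoning

ceilSum : ℕ → ℕ → ℕ
ceilSum k m = ∑< m (λ j → ⌈ k / suc j ⌉)

ceilSum-block-≤ : ∀ k j → ∑< (suc j) (λ i → ⌈ k / suc (j + i) ⌉) ≤ k + j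
ceilSum-block-≤ k j = begin
  ∑< (suc j) (λ i → ⌈ k / suc (j + i) ⌉)  ≤⟨ ∑<-≤-* (suc j) _ (λ i → ⌈m/n⌉-antiʳ-≤ k (s≤s (m≤m+n j i))) ⟩
  suc j * ⌈ k / suc j ⌉                   ≡⟨ *-comm (suc j) _ ⟩
  ⌈ k / suc j ⌉ * suc j                   ≤⟨ ⌈m/1+j⌉*[1+j]≤m+j k j ⟩
  k + j                                   ∎
  where open ≤-Reasoning

ceilSum-block-≥ : ∀ k j → k ≤ 2 * ∑< (suc j) (λ i → ⌈ k / suc (j + i) ⌉)
ceilSum-block-≥ k j = begin
  k                                           ≤⟨ m≤⌈m/n⌉*n k (suc (j + j)) ⟩
  c * suc (j + j)                             ≤⟨ m≤m+n _ c ⟩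
  c * suc (j + j) + c                         ≡⟨ double j c ⟨
  2 * (suc j * c)                             ≤⟨ *-monoʳ-≤ 2 (*-≤-∑< (suc j) _ c≤term) ⟩
  2 * ∑< (suc j) (λ i → ⌈ k / suc (j + i) ⌉)  ∎
  where
  open ≤-Reasoning
  c : ℕ
  c = ⌈ k / suc (j + j) ⌉
  c≤term : ∀ i → i < suc j → c ≤ ⌈ k / suc (j + i) ⌉
  c≤term i i≤j = ⌈m/n⌉-antiʳ-≤ k (s≤s (+-monoʳ-≤ j (≤-pred i≤j)))
  double : ∀ j c → 2 * (suc j * c) ≡ c * suc (j + j) + c
  double = solve-∀

mersenne : ℕ → ℕ
mersenne zero    = 0
mersenne (suc p) = mersenne p + suc (mersenne p)

1+mersenne≡2^ : ∀ p → suc (mersenne p) ≡ 2 ^ p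
1+mersenne≡2^ zero    = refl
1+mersenne≡2^ (suc p) = begin
  suc (mersenne p + suc (mersenne p))  ≡⟨ cong (λ x → x + x) (1+mersenne≡2^ p) ⟩
  2 ^ p + 2 ^ p                        ≡⟨ cong (_+_ (2 ^ p)) (+-identityʳ (2 ^ p)) ⟨
  2 ^ suc p                            ∎
  where open ≡-Reasoning

ceilSum-mersenne-≤ : ∀ k p → ceilSum k (mersenne p) ≤ p * k + mersenne p
ceilSum-mersenne-≤ k zero    = z≤n
ceilSum-mersenne-≤ k (suc p) = begin
  ceilSum k (M + suc M)                                   ≡⟨ ∑<-split M (suc M) _ ⟩
  ceilSum k M + ∑< (suc M) (λ i → ⌈ k / suc (M + i) ⌉)
    ≤⟨ +-mono-≤ (ceilSum-mersenne-≤ k p) (ceilSum-block-≤ k M) ⟩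
  (p * k + M) + (k + M)                                   ≤⟨ m≤m+n _ 1 ⟩
  (p * k + M) + (k + M) + 1                               ≡⟨ regroup (p * k) k M ⟩
  suc p * k + (M + suc M)                                 ∎
  where
  open ≤-Reasoning
  M : ℕ
  M = mersenne p
  regroup : ∀ a k m → (a + m) + (k + m) + 1 ≡ (k + a) + (m + suc m)
  regroup = solve-∀

ceilSum-mersenne-≥ : ∀ k p → p * k ≤ 2 * ceilSum k (mersenne p)
ceilSum-mersenne-≥ k zero    = z≤n
ceilSum-mersenne-≥ k (suc p) = begin
  k + p * k                                         ≤⟨ +-mono-≤ (ceilSum-block-≥ k M) (ceilSum-mersenne-≥ k p) ⟩
  2 * block + 2 * ceilSum k M                       ≡⟨ +-comm (2 * block) _ ⟩
  2 * ceilSum k M + 2 * block                       ≡⟨ *-distribˡ-+ 2 (ceilSum k M) block ⟨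
  2 * (ceilSum k M + block)                         ≡⟨ cong (2 *_) (∑<-split M (suc M) _) ⟨
  2 * ceilSum k (M + suc M)                         ∎
  where
  open ≤-Reasoning
  M : ℕ
  M = mersenne p
  block : ℕ
  block = ∑< (suc M) (λ i → ⌈ k / suc (M + i) ⌉)

2^⌊log₂n⌋≤n : ∀ n .{{_ : NonZero n}} → 2 ^ ⌊log₂ n ⌋ ≤ n
2^⌊log₂n⌋≤n n = <-rec (λ n → 1 ≤ n → 2 ^ ⌊log₂ n ⌋ ≤ n) step n (>-nonZero⁻¹ n)
  where
  step : ∀ n → (∀ {h} → h < n → 1 ≤ h → 2 ^ ⌊log₂ h ⌋ ≤ h) → 1 ≤ n → 2 ^ ⌊log₂ n ⌋ ≤ n
  step 1 _ _ = ≤-refl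
  step n@(suc (suc y)) rec _ = begin
    2 ^ ⌊log₂ n ⌋                ≤⟨ ^-monoʳ-≤ 2 (m≤n+m∸n ⌊log₂ n ⌋ 1) ⟩
    2 * 2 ^ (⌊log₂ n ⌋ ∸ 1)      ≡⟨ cong (λ e → 2 * 2 ^ e) (⌊log₂⌊n/2⌋⌋≡⌊log₂n⌋∸1 n) ⟨
    2 * 2 ^ ⌊log₂ h ⌋            ≤⟨ *-monoʳ-≤ 2 (rec (⌊n/2⌋<n (suc y)) (s≤s z≤n)) ⟩
    2 * h                        ≡⟨ cong (_+_ h) (+-identityʳ h) ⟩
    h + h                        ≤⟨ +-monoʳ-≤ h (⌊n/2⌋≤⌈n/2⌉ n) ⟩
    h + ⌈ n /2⌉                  ≡⟨ ⌊n/2⌋+⌈n/2⌉≡n n ⟩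
    n                            ∎
    where
    open ≤-Reasoning
    h : ℕ
    h = ⌊ n /2⌋

n<2^[1+⌊log₂n⌋] : ∀ n → n < 2 ^ suc ⌊log₂ n ⌋
n<2^[1+⌊log₂n⌋] n = ≰⇒> λ 2^[1+L]≤n → 1+n≰n (begin
  suc ⌊log₂ n ⌋                ≡⟨ ⌊log₂[2^n]⌋≡n (suc ⌊log₂ n ⌋) ⟨
  ⌊log₂ 2 ^ suc ⌊log₂ n ⌋ ⌋    ≤⟨ ⌊log₂⌋-mono-≤ 2^[1+L]≤n ⟩
  ⌊log₂ n ⌋                    ∎)
  where open ≤-Reasoning

ceilSum-≤-k*log : ∀ k m → 2 ≤ m → m ≤ k → ceilSum k m ≤ 4 * (k * ⌊log₂ m ⌋)
ceilSum-≤-k*log k m 2≤m m≤k = begin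
  ceilSum k m                ≤⟨ ∑<-mono-≤ _ m≤M ⟩
  ceilSum k M                ≤⟨ ceilSum-mersenne-≤ k (suc L) ⟩
  suc L * k + M              ≤⟨ +-monoʳ-≤ (suc L * k) M≤2k ⟩
  suc L * k + 2 * k          ≤⟨ absorb L k (⌊log₂⌋-mono-≤ 2≤m) ⟩
  4 * (k * L)                ∎
  where
  open ≤-Reasoning
  L M : ℕ
  L = ⌊log₂ m ⌋
  M = mersenne (suc L)
  1+M≡2*2^L : suc M ≡ 2 * 2 ^ L
  1+M≡2*2^L = 1+mersenne≡2^ (suc L)
  m≤M : m ≤ M
  m≤M = ≤-pred (≤-trans (n<2^[1+⌊log₂n⌋] m) (≤-reflexive (sym 1+M≡2*2^L)))
  M≤2k : M ≤ 2 * k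
  M≤2k = ≤-trans (n≤1+n M) (≤-trans (≤-reflexive 1+M≡2*2^L)
           (*-monoʳ-≤ 2 (≤-trans (2^⌊log₂n⌋≤n m {{>-nonZero (≤-trans z<s 2≤m)}}) m≤k)))
  absorb : ∀ L k → 1 ≤ L → suc L * k + 2 * k ≤ 4 * (k * L)
  absorb (suc L) k _ = begin
    suc (suc L) * k + 2 * k                  ≤⟨ m≤m+n _ (3 * (L * k)) ⟩
    suc (suc L) * k + 2 * k + 3 * (L * k)    ≡⟨ expand L k ⟩
    4 * (k * suc L)                          ∎
    where
    expand : ∀ L k → suc (suc L) * k + 2 * k + 3 * (L * k) ≡ 4 * (k * suc L)
    expand = solve-∀

ceilSum-≥-k*log : ∀ k m → k * ⌊log₂ (suc m) ⌋ ≤ 2 * ceilSum k m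
ceilSum-≥-k*log k m = begin
  k * L                        ≡⟨ *-comm k L ⟩
  L * k                        ≤⟨ ceilSum-mersenne-≥ k L ⟩
  2 * ceilSum k (mersenne L)   ≤⟨ *-monoʳ-≤ 2 (∑<-mono-≤ _ mersenne≤m) ⟩
  2 * ceilSum k m              ∎
  where
  open ≤-Reasoning
  L : ℕ
  L = ⌊log₂ (suc m) ⌋
  mersenne≤m : mersenne L ≤ m
  mersenne≤m = ≤-pred (≤-trans (≤-reflexive (1+mersenne≡2^ L)) (2^⌊log₂n⌋≤n (suc m)))

-- Built with mkℚ rather than _/_, so that numerator and denominator are definitionally c and 1.
toℚ : ℕ → ℚ
toℚ c = mkℚ (+ c) 0 (Coprimality.sym (1-coprimeTo c))

c≤q⇒c≤floor[q] : ∀ c q → toℚ c ℚ.≤ q → + c ℤ.≤ floor q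
c≤q⇒c≤floor[q] c (mkℚ (+ a) d _) (ℚ.*≤* c*[1+d]≤a*1) =
  subst (+ c ℤ.≤_) (sym (ℤP.*-identityˡ (+ (a / suc d)))) (+≤+ (begin
    c                    ≡⟨ m*n/n≡m c (suc d) ⟨
    c * suc d / suc d    ≤⟨ /-monoˡ-≤ (suc d) (≤-trans c*[1+d]≤a (≤-reflexive (*-identityʳ a))) ⟩
    a / suc d            ∎))
  where
  open ≤-Reasoning
  c*[1+d]≤a : c * suc d ≤ a * 1
  c*[1+d]≤a = ℤ.drop‿+≤+ (subst₂ ℤ._≤_ (sym (ℤP.pos-* c (suc d))) (sym (ℤP.pos-* a 1)) c*[1+d]≤a*1)
c≤q⇒c≤floor[q] c (mkℚ -[1+ a ] d _) (ℚ.*≤* c*[1+d]≤-a) with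
  subst₂ ℤ._≤_ (sym (ℤP.pos-* c (suc d))) (ℤP.*-identityʳ -[1+ a ]) c*[1+d]≤-a
... | ()

module _ (l : ℚ) (0<l : 0ℚ ℚ.< l) where
  instance
    _ = positive 0<l
    _ = ℚP.pos⇒nonZero l
    _ = ℚP.pos⇒nonNeg (1/ l) {{ℚP.1/pos⇒pos l}}

  l*c≤x⇒c≤floor[x÷l] : ∀ x c → l ℚ.* toℚ c ℚ.≤ x → + c ℤ.≤ floor (x ÷ l)
  l*c≤x⇒c≤floor[x÷l] x c l*c≤x = c≤q⇒c≤floor[q] c (x ÷ l) (begin
    toℚ c                    ≡⟨ ℚP.*-identityʳ (toℚ c) ⟨
    toℚ c ℚ.* 1ℚ             ≡⟨ cong (toℚ c ℚ.*_) (ℚP.*-inverseʳ l) ⟨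
    toℚ c ℚ.* (l ℚ.* 1/ l)   ≡⟨ ℚP.*-assoc (toℚ c) l (1/ l) ⟨
    toℚ c ℚ.* l ℚ.* 1/ l     ≡⟨ cong (ℚ._* 1/ l) (ℚP.*-comm (toℚ c) l) ⟩
    l ℚ.* toℚ c ℚ.* 1/ l     ≤⟨ ℚP.*-monoʳ-≤-nonNeg (1/ l) l*c≤x ⟩
    x ÷ l                    ∎)
    where open ℚP.≤-Reasoning

r*c≤Σℤ : ∀ n r c (f : Fin n → ℤ) → r ≤ n → (∀ j → + 0 ℤ.≤ f j) →
         (∀ j → toℕ j < r → + c ℤ.≤ f j) → + (r * c) ℤ.≤ Σℤ n f
r*c≤Σℤ zero    zero    c f _ _ _ = ℤP.≤-refl
r*c≤Σℤ (suc n) zero    c f _ f≥0 _ =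
  ℤP.+-mono-≤ (f≥0 Fin.zero) (r*c≤Σℤ n zero c (f ∘ Fin.suc) z≤n (f≥0 ∘ Fin.suc) (λ _ ()))
r*c≤Σℤ (suc n) (suc r) c f (s≤s r≤n) f≥0 f≥c =
  subst (ℤ._≤ Σℤ (suc n) f) (sym (ℤP.pos-+ c (r * c)))
    (ℤP.+-mono-≤ (f≥c Fin.zero z<s)
       (r*c≤Σℤ n r c (f ∘ Fin.suc) r≤n (f≥0 ∘ Fin.suc) (λ j j<r → f≥c (Fin.suc j) (s<s j<r))))

feasible-of-prefix : ∀ {n} k (L : Sticks n) l (0<l : 0ℚ ℚ.< l) r c →
                     AllPositive L → r ≤ n → k ≤ r * c →
                     (∀ j → toℕ j < r → l ℚ.* toℚ c ℚ.≤ L j) → Feasible k L l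
feasible-of-prefix {n} k L l 0<l r c L>0 r≤n k≤r*c prefix≥l*c = 0<l , ℤP.≤-trans (+≤+ k≤r*c)
  (r*c≤Σℤ n r c _ r≤n (λ j → l*c≤x⇒c≤floor[x÷l] l 0<l (L j) 0 (l*0≤L j))
                      (λ j j<r → l*c≤x⇒c≤floor[x÷l] l 0<l (L j) c (prefix≥l*c j j<r)))
  where
  l*0≤L : ∀ j → l ℚ.* toℚ 0 ℚ.≤ L j
  l*0≤L j = subst (ℚ._≤ L j) (sym (ℚP.*-zeroʳ l)) (ℚP.<⇒≤ (L>0 j))

[1/n]*n≡1 : ∀ q → (+ 1 ℚ./ suc q) ℚ.* toℚ (suc q) ≡ 1ℚ
[1/n]*n≡1 q = ℚP.toℚᵘ-injective (ℚᵘP.≃-trans (ℚP.toℚᵘ-homo-* (+ 1 ℚ./ suc q) (toℚ (suc q)))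
  (ℚᵘP.≃-trans (ℚᵘP.*-congʳ (ℚP.toℚᵘ-fromℚᵘ (ℚᵘ.mkℚᵘ (+ 1) q)))
              (ℚᵘ.*≡* (ℤP.*-assoc (+ 1) (+ suc q) (+ 1)))))

divN*n≡L : ∀ L q → divN L (suc q) ℚ.* toℚ (suc q) ≡ L
divN*n≡L L q = begin
  L ℚ.* (+ 1 ℚ./ suc q) ℚ.* toℚ (suc q)    ≡⟨ ℚP.*-assoc L _ _ ⟩
  L ℚ.* ((+ 1 ℚ./ suc q) ℚ.* toℚ (suc q))  ≡⟨ cong (L ℚ.*_) ([1/n]*n≡1 q) ⟩
  L ℚ.* 1ℚ                                 ≡⟨ ℚP.*-identityʳ L ⟩
  L                                        ∎
  where open ≡-Reasoning

divN-pos : ∀ L q → 0ℚ ℚ.< L → 0ℚ ℚ.< divN L (suc q)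
divN-pos L q 0<L =
  ℚP.positive⁻¹ _ {{ℚP.pos*pos⇒pos L {{positive 0<L}} (+ 1 ℚ./ suc q) {{ℚP.normalize-pos 1 (suc q)}}}}

Lco-cases : ∀ {n} k0 (L : Sticks n) →
            (n ≤ k0 × Lco (suc k0) L ≡ 0ℚ) ⊎ Σ (Fin n) (λ i → toℕ i ≡ k0 × Lco (suc k0) L ≡ L i)
Lco-cases {n} k0 L with k0 <? n
... | yes k0<n = inj₂ (fromℕ< k0<n , toℕ-fromℕ< k0<n , refl)
... | no  k0≮n = inj₁ (≮⇒≥ k0≮n , refl)

∈Ico⇒Lco<L : ∀ {n} k (L : Sticks n) i → i ∈I Ico k L → Lco k L ℚ.< L i
∈Ico⇒Lco<L k L i i∈I = invert (subst (Reflects _) i∈I (proof (Lco k L ℚP.<? L i)))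

∉Ico⇒L≤Lco : ∀ {n} k (L : Sticks n) i → ¬ (i ∈I Ico k L) → L i ℚ.≤ Lco k L
∉Ico⇒L≤Lco k L i i∉I = ℚP.≮⇒≥ (λ Lco<L → i∉I (dec-true (Lco k L ℚP.<? L i) Lco<L))

∈Ico⇒toℕ<k-1 : ∀ {n} k0 (L : Sticks n) → NonIncreasing L → ∀ i → i ∈I Ico (suc k0) L → toℕ i < k0
∈Ico⇒toℕ<k-1 k0 L L↓ i i∈I with Lco-cases k0 L
... | inj₁ (n≤k0 , _) = <-≤-trans (toℕ<n i) n≤k0
... | inj₂ (i₀ , i₀≡k0 , Lco≡L[i₀]) = ≰⇒> λ k0≤i →
  ℚP.<-irrefl refl (ℚP.<-≤-trans (subst (ℚ._< L i) Lco≡L[i₀] (∈Ico⇒Lco<L (suc k0) L i i∈I))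
                               (L↓ i₀ i (subst (_≤ toℕ i) (sym i₀≡k0) k0≤i)))

feasible-L/⌈k/i⌉ : ∀ {n} k0 (L : Sticks n) → AllPositive L → NonIncreasing L →
                   ∀ i → Feasible (suc k0) L (divN (L i) (suc (k0 / suc (toℕ i))))
feasible-L/⌈k/i⌉ k0 L L>0 L↓ i =
  feasible-of-prefix (suc k0) L l (divN-pos (L i) q (L>0 i)) (suc (toℕ i)) (suc q) L>0 (toℕ<n i) k≤i*q
    (λ j j≤i → subst (ℚ._≤ L j) (sym (divN*n≡L (L i) q)) (L↓ j i (≤-pred j≤i)))
  where
  q : ℕ
  q = k0 / suc (toℕ i)
  l : ℚ
  l = divN (L i) (suc q)
  k≤i*q : suc k0 ≤ suc (toℕ i) * suc q
  k≤i*q = begin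
    suc k0                                  ≤⟨ m≤⌈m/n⌉*n (suc k0) (suc (toℕ i)) ⟩
    ⌈ suc k0 / suc (toℕ i) ⌉ * suc (toℕ i)  ≡⟨ cong (_* suc (toℕ i)) (⌈1+m/n⌉≡1+m/n k0 (suc (toℕ i))) ⟩
    suc q * suc (toℕ i)                     ≡⟨ *-comm (suc q) _ ⟩
    suc (toℕ i) * suc q                     ∎
    where open ≤-Reasoning

feasible-≤L[k] : ∀ {n} k0 (L : Sticks n) → AllPositive L → NonIncreasing L →
                 ∀ i₀ → toℕ i₀ ≡ k0 → ∀ x → 0ℚ ℚ.< x → x ℚ.≤ L i₀ → Feasible (suc k0) L x
feasible-≤L[k] k0 L L>0 L↓ i₀ i₀≡k0 x 0<x x≤L[i₀] =
  feasible-of-prefix (suc k0) L x 0<x (suc k0) 1 L>0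
    (subst (_< _) i₀≡k0 (toℕ<n i₀)) (≤-reflexive (sym (*-identityʳ _)))
    (λ j j≤k0 → subst (ℚ._≤ L j) (sym (ℚP.*-identityʳ x))
                  (ℚP.≤-trans x≤L[i₀] (L↓ j i₀ (subst (toℕ j ≤_) (sym i₀≡k0) (≤-pred j≤k0)))))

∉Ico⇒feasible∧≢l⋆ : ∀ {n} k0 (L : Sticks n) → ValidInput (suc k0) L →
                    ∀ i → ¬ (i ∈I Ico (suc k0) L) → Feasible (suc k0) L (L i) × ¬ IsLstar (suc k0) L (L i)
∉Ico⇒feasible∧≢l⋆ k0 L (L>0 , L↓ , Lco≢l⋆) i i∉I with Lco-cases k0 L
... | inj₁ (_ , Lco≡0) =
  ⊥-elim (ℚP.<-irrefl refl (ℚP.<-≤-trans (L>0 i) (subst (L i ℚ.≤_) Lco≡0 L[i]≤Lco)))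
  where
  L[i]≤Lco : L i ℚ.≤ Lco (suc k0) L
  L[i]≤Lco = ∉Ico⇒L≤Lco (suc k0) L i i∉I
... | inj₂ (i₀ , i₀≡k0 , Lco≡L[i₀]) = feasible (L i) (L>0 i) L[i]≤L[i₀] , L[i]≢l⋆
  where
  feasible : ∀ x → 0ℚ ℚ.< x → x ℚ.≤ L i₀ → Feasible (suc k0) L x
  feasible = feasible-≤L[k] k0 L L>0 L↓ i₀ i₀≡k0
  L[i]≤L[i₀] : L i ℚ.≤ L i₀
  L[i]≤L[i₀] = subst (L i ℚ.≤_) Lco≡L[i₀] (∉Ico⇒L≤Lco (suc k0) L i i∉I)
  L[i]≢l⋆ : ¬ IsLstar (suc k0) L (L i)
  L[i]≢l⋆ l⋆@(_ , maximal) = Lco≢l⋆ (subst (IsLstar (suc k0) L) L[i]≡Lco l⋆)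
    where
    L[i]≡Lco : L i ≡ Lco (suc k0) L
    L[i]≡Lco = trans (ℚP.≤-antisym L[i]≤L[i₀] (maximal (L i₀) (feasible (L i₀) (L>0 i₀) ℚP.≤-refl)))
                     (sym Lco≡L[i₀])

Ico-admissible : ∀ n k → 1 ≤ k → (L : Sticks n) → ValidInput k L → Admissible k L (Ico k L) one (fuCo k)
Ico-admissible n (suc k0) _ L valid@(L>0 , L↓ , _) =
  (λ i _ → inj₁ refl , k0 / suc (toℕ i) , ⌈1+m/n⌉≡1+m/n k0 (suc (toℕ i)) , feasible-L/⌈k/i⌉ k0 L L>0 L↓ i)
  , ∉Ico⇒feasible∧≢l⋆ k0 L valid

length-concat : ∀ {A : Set} (xss : List (List A)) → length (concat xss) ≡ sum (map length xss)
length-concat []         = refl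
length-concat (xs ∷ xss) = trans (length-++ xs) (cong (_+_ (length xs)) (length-concat xss))

length-C : ∀ {n} (L : Sticks n) I fl fu →
           length (C L I fl fu) ≡ sum (tabulate (λ i → if I i then suc (fu i) ∸ fl i else 0))
length-C {n} L I fl fu = begin
  length (concat (map F (allFin n)))    ≡⟨ length-concat (map F (allFin n)) ⟩
  sum (map length (map F (allFin n)))   ≡⟨ cong sum (map-∘ (allFin n)) ⟨
  sum (map (length ∘ F) (allFin n))     ≡⟨ cong sum (map-tabulate id (length ∘ F)) ⟩
  sum (tabulate (length ∘ F))           ≡⟨ cong sum (tabulate-cong length-F) ⟩
  sum (tabulate h)                      ∎
  where
  open ≡-Reasoning
  F : Fin n → List ℚ
  F i = if I i then map (λ t → divN (L i) (fl i + t)) (upTo (suc (fu i) ∸ fl i)) else []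
  h : Fin n → ℕ
  h i = if I i then suc (fu i) ∸ fl i else 0
  length-F : ∀ i → length (F i) ≡ h i
  length-F i with I i
  ... | true  = trans (length-map _ (upTo (suc (fu i) ∸ fl i))) (length-upTo _)
  ... | false = refl

sum-tabulate-≤-∑< : ∀ {n} m (h : Fin n → ℕ) G → (∀ i → m ≤ toℕ i → h i ≡ 0) →
                    (∀ i → toℕ i < m → h i ≤ G (toℕ i)) → sum (tabulate h) ≤ ∑< m G
sum-tabulate-≤-∑< {zero}  m       h G _ _ = z≤n
sum-tabulate-≤-∑< {suc n} zero    h G h≡0 _ =
  ≤-reflexive (cong₂ _+_ (h≡0 Fin.zero z≤n)
    (n≤0⇒n≡0 (sum-tabulate-≤-∑< zero (h ∘ Fin.suc) G (λ i _ → h≡0 (Fin.suc i) z≤n) (λ _ ()))))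
sum-tabulate-≤-∑< {suc n} (suc m) h G h≡0 h≤G =
  +-mono-≤ (h≤G Fin.zero z<s)
    (sum-tabulate-≤-∑< m (h ∘ Fin.suc) (G ∘ suc)
       (λ i m≤i → h≡0 (Fin.suc i) (s≤s m≤i)) (λ i i<m → h≤G (Fin.suc i) (s<s i<m)))

∑<-≤-sum-tabulate : ∀ {n} m (h : Fin n → ℕ) G → m ≤ n →
                    (∀ i → toℕ i < m → G (toℕ i) ≤ h i) → ∑< m G ≤ sum (tabulate h)
∑<-≤-sum-tabulate zero    h G _ _ = z≤n
∑<-≤-sum-tabulate {suc n} (suc m) h G (s≤s m≤n) G≤h =
  +-mono-≤ (G≤h Fin.zero z<s)
    (∑<-≤-sum-tabulate m (h ∘ Fin.suc) (G ∘ suc) m≤n (λ i i<m → G≤h (Fin.suc i) (s<s i<m)))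

sizeCco≡sum : ∀ {n} k (L : Sticks n) → sizeCco k L ≡ sum (tabulate (λ i → if Ico k L i then fuCo k i else 0))
sizeCco≡sum k L = length-C L (Ico k L) one (fuCo k)

sizeCco-≤ : ∀ n k → 2 ≤ n → 2 ≤ k → (L : Sticks n) → ValidInput k L →
            sizeCco k L ≤ 4 * (k * ⌊log₂ (k ⊓ n) ⌋)
sizeCco-≤ n k@(suc k0) 2≤n 2≤k L (_ , L↓ , _) = begin
  sizeCco k L             ≡⟨ sizeCco≡sum k L ⟩
  sum (tabulate h)        ≤⟨ sum-tabulate-≤-∑< (k0 ⊓ n) h (λ j → ⌈ k / suc j ⌉) h≡0 h≤fuCo ⟩
  ceilSum k (k0 ⊓ n)      ≤⟨ ∑<-mono-≤ _ (⊓-monoˡ-≤ n (n≤1+n k0)) ⟩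
  ceilSum k (k ⊓ n)       ≤⟨ ceilSum-≤-k*log k (k ⊓ n) (⊓-glb 2≤k 2≤n) (m⊓n≤m k n) ⟩
  4 * (k * ⌊log₂ (k ⊓ n) ⌋) ∎
  where
  open ≤-Reasoning
  h : Fin n → ℕ
  h i = if Ico k L i then fuCo k i else 0
  h≡0 : ∀ i → k0 ⊓ n ≤ toℕ i → h i ≡ 0
  h≡0 i k0⊓n≤i with Ico k L i in i∈I
  ... | true  = ⊥-elim (<⇒≱ (⊓-glb (∈Ico⇒toℕ<k-1 k0 L L↓ i i∈I) (toℕ<n i)) k0⊓n≤i)
  ... | false = refl
  h≤fuCo : ∀ i → toℕ i < k0 ⊓ n → h i ≤ fuCo k i
  h≤fuCo i _ with Ico k L i
  ... | true  = ≤-refl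
  ... | false = z≤n

twoLevel : ∀ {n} → ℕ → Sticks n
twoLevel k0 i with toℕ i <? k0
... | yes _ = toℚ 3
... | no  _ = 1ℚ

module TwoLevel {n : ℕ} (k0 : ℕ) where
  private
    L : Sticks n
    L = twoLevel k0

  twoLevel-< : ∀ i → toℕ i < k0 → L i ≡ toℚ 3
  twoLevel-< i i<k0 with toℕ i <? k0
  ... | yes _    = refl
  ... | no  i≮k0 = ⊥-elim (i≮k0 i<k0)

  twoLevel-≥ : ∀ i → k0 ≤ toℕ i → L i ≡ 1ℚ
  twoLevel-≥ i k0≤i with toℕ i <? k0
  ... | yes i<k0 = ⊥-elim (<⇒≱ i<k0 k0≤i)
  ... | no  _    = refl

  1≤twoLevel : ∀ i → 1ℚ ℚ.≤ L i
  1≤twoLevel i with toℕ i <? k0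
  ... | yes _ = from-yes (1ℚ ℚP.≤? toℚ 3)
  ... | no  _ = ℚP.≤-refl

  twoLevel-valid : 1 ≤ k0 → ValidInput (suc k0) L
  twoLevel-valid 1≤k0 = L>0 , L↓ , Lco≢l⋆
    where
    L>0 : AllPositive L
    L>0 i = ℚP.<-≤-trans (from-yes (0ℚ ℚP.<? 1ℚ)) (1≤twoLevel i)
    L↓ : NonIncreasing L
    L↓ i j i≤j with toℕ j <? k0
    ... | yes j<k0 = ℚP.≤-reflexive (sym (twoLevel-< i (≤-<-trans i≤j j<k0)))
    ... | no  _    = 1≤twoLevel i
    Lco≢l⋆ : ¬ IsLstar (suc k0) L (Lco (suc k0) L)
    Lco≢l⋆ ((0<Lco , _) , maximal) with Lco-cases k0 L
    ... | inj₁ (_ , Lco≡0) = ℚP.<-irrefl (sym Lco≡0) 0<Lco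
    ... | inj₂ (i₀ , i₀≡k0 , Lco≡L[i₀]) = from-no (3/2 ℚP.≤? 1ℚ) (begin
      3/2               ≤⟨ maximal 3/2 3/2-feasible ⟩
      Lco (suc k0) L    ≡⟨ Lco≡L[i₀] ⟩
      L i₀              ≡⟨ twoLevel-≥ i₀ (≤-reflexive (sym i₀≡k0)) ⟩
      1ℚ                ∎)
      where
      open ℚP.≤-Reasoning
      3/2 : ℚ
      3/2 = + 3 ℚ./ 2
      3/2-feasible : Feasible (suc k0) L 3/2
      3/2-feasible = feasible-of-prefix (suc k0) L 3/2 (from-yes (0ℚ ℚP.<? 3/2)) k0 2 L>0
        (subst (_≤ n) i₀≡k0 (<⇒≤ (toℕ<n i₀))) k≤k0*2
        (λ j j<k0 → subst (3/2 ℚ.* toℚ 2 ℚ.≤_) (sym (twoLevel-< j j<k0)) (from-yes (3/2 ℚ.* toℚ 2 ℚP.≤? toℚ 3)))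
        where
        k≤k0*2 : suc k0 ≤ k0 * 2
        k≤k0*2 = subst (suc k0 ≤_) (*-comm 2 k0) (+-mono-≤ 1≤k0 (≤-reflexive (sym (+-identityʳ k0))))

  twoLevel-∈Ico : ∀ i → toℕ i < k0 → i ∈I Ico (suc k0) L
  twoLevel-∈Ico i i<k0 =
    dec-true (Lco (suc k0) L ℚP.<? L i) (subst (Lco (suc k0) L ℚ.<_) (sym (twoLevel-< i i<k0)) Lco<3)
    where
    Lco<3 : Lco (suc k0) L ℚ.< toℚ 3
    Lco<3 with Lco-cases k0 L
    ... | inj₁ (_ , Lco≡0) = subst (ℚ._< toℚ 3) (sym Lco≡0) (from-yes (0ℚ ℚP.<? toℚ 3))
    ... | inj₂ (i₀ , i₀≡k0 , Lco≡L[i₀]) =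
      subst (ℚ._< toℚ 3) (sym (trans Lco≡L[i₀] (twoLevel-≥ i₀ (≤-reflexive (sym i₀≡k0)))))
            (from-yes (1ℚ ℚP.<? toℚ 3))

sizeCco-≥-attained : ∀ n k → 2 ≤ n → 2 ≤ k →
                     Σ (Sticks n) (λ L → ValidInput k L × k * ⌊log₂ (k ⊓ n) ⌋ ≤ 2 * sizeCco k L)
sizeCco-≥-attained n k@(suc k0) _ (s≤s 1≤k0) = L , twoLevel-valid 1≤k0 , (begin
  k * ⌊log₂ (k ⊓ n) ⌋          ≤⟨ *-monoʳ-≤ k (⌊log₂⌋-mono-≤ (⊓-monoʳ-≤ k (n≤1+n n))) ⟩
  k * ⌊log₂ suc (k0 ⊓ n) ⌋     ≤⟨ ceilSum-≥-k*log k (k0 ⊓ n) ⟩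
  2 * ceilSum k (k0 ⊓ n)       ≤⟨ *-monoʳ-≤ 2 (∑<-≤-sum-tabulate (k0 ⊓ n) h _ (m⊓n≤n k0 n) fuCo≤h) ⟩
  2 * sum (tabulate h)         ≡⟨ cong (2 *_) (sizeCco≡sum k L) ⟨
  2 * sizeCco k L              ∎)
  where
  open ≤-Reasoning
  open TwoLevel k0
  L : Sticks n
  L = twoLevel k0
  h : Fin n → ℕ
  h i = if Ico k L i then fuCo k i else 0
  fuCo≤h : ∀ i → toℕ i < k0 ⊓ n → fuCo k i ≤ h i
  fuCo≤h i i<k0⊓n rewrite twoLevel-∈Ico i (<-≤-trans i<k0⊓n (m⊓n≤m k0 n)) = ≤-refl

lemma8 :
    (∀ (n k : ℕ) → 1 ≤ k → (L : Sticks n) → ValidInput k L →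
        Admissible k L (Ico k L) one (fuCo k))
    ×
    Σ ℕ (λ c₁ → Σ ℕ (λ c₂ →
        (∀ (n k : ℕ) → 2 ≤ n → 2 ≤ k → (L : Sticks n) → ValidInput k L →
            sizeCco k L ≤ c₂ * (k * ⌊log₂ (k ⊓ n) ⌋))
        ×
        (∀ (n k : ℕ) → 2 ≤ n → 2 ≤ k →
            Σ (Sticks n) (λ L → ValidInput k L × k * ⌊log₂ (k ⊓ n) ⌋ ≤ c₁ * sizeCco k L))))
lemma8 = Ico-admissible , 2 , 4 , sizeCco-≤ , sizeCco-≥-attained
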